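{- Let $n,m,j\in\mathbb{Z}^+$ with $m\ge3$ and $1\le j<m/2$, and let $G(m,j)$ be the generalized Petersen graph. Then: (1) if $8\nmid n$, then $\chi_{n,2}(G(m,j))$ exists; (2) if $8\mid n$ and $2\nmid m$, then $\chi_{n,2}(G(m,j))$ does not exist; (3) if $8\mid n$, $2\mid m$ and $2\nmid j$, then $\chi_{n,2}(G(m,j))$ exists; (4) if $8\mid n$, $2\mid m$, $4\nmid m$ and $2\mid j$, then $\chi_{n,2}(G(m,j))$ exists if and only if $16\nmid n$.
   Context: The generalized Petersen graph $G(m,j)$ has vertex set $\{v_i,u_i: i\in\mathbb{Z}_m\}$ and edge set $\{v_iv_{i+1}, v_iu_i, u_iu_{i+j}: i\in\mathbb{Z}_m\}$ (indices mod $m$). For a graph $G=(V,E)$, a labeling $\ell:V\to\mathbb{Z}$ is proper if adjacent vertices get distinct labels, and it is a closed coloring with remainder $k\bmod n$ if $\sum_{w\in N[v]}\ell(w)\equiv k\pmod n$ for every $v$, where $N[v]$ is the closed neighborhood of $v$. $\chi_{n,k}(G)$ exists iff a proper closed coloring with remainder $k\bmod n$ exists. -}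

module Defs where

open import Data.Nat as ℕ using (ℕ; zero; suc; NonZero)
open import Data.Nat.DivMod using (_%_)
import Data.Nat.DivMod
import Data.Sum
open import Data.Fin as Fin using (Fin; toℕ)
open import Data.Fin.Properties using (_≟_)
open import Data.Bool using (Bool; true; false; if_then_else_; _∨_)
open import Data.Integer as ℤ using (ℤ)
open import Data.Integer.Divisibility using (_∣_)
open import Data.List using (List; foldr; map; allFin)
open import Data.Product using (_×_; Σ; ∃)
open import Relation.Nullary using (¬_; does)
open import Relation.Binary.PropositionalEquality using (_≡_)

record Graph : Set where
  field
    N   : ℕ
    adj : Fin N → Fin N → Bool
open Graph public

closedSum : (G : Graph) → (Fin (N G) → ℤ) → Fin (N G) → ℤ
closedSum G ℓ v =
  ℓ v ℤ.+ foldr ℤ._+_ ℤ.0ℤ (map (λ w → if adj G v w then ℓ w else ℤ.0ℤ) (allFin (N G)))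

Proper : (G : Graph) → (Fin (N G) → ℤ) → Set
Proper G ℓ = ∀ v w → adj G v w ≡ true → ¬ (ℓ v ≡ ℓ w)

ClosedColoring : (G : Graph) → ℕ → ℤ → (Fin (N G) → ℤ) → Set
ClosedColoring G n k ℓ = ∀ v → ℤ.+ n ∣ (closedSum G ℓ v ℤ.- k)

ChiExists : Graph → ℕ → ℤ → Set
ChiExists G n k = ∃ λ ℓ → Proper G ℓ × ClosedColoring G n k ℓ

_+ₘ_ : {m : ℕ} .{{_ : NonZero m}} → Fin m → ℕ → Fin m
_+ₘ_ {m} i a = Fin.fromℕ< (Data.Nat.DivMod.m%n<n (toℕ i ℕ.+ a) m)

eqb : {m : ℕ} → Fin m → Fin m → Bool
eqb i i' = does (i ≟ i')

-- Generalized Petersen graph G(m,j): vertex v_i is inject₁ i (i : Fin m), u_i is raise m i.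
-- Edges: v_i v_{i+1}, v_i u_i, u_i u_{i+j} (indices mod m), taken symmetrically.
petersenAdj : (m j : ℕ) .{{_ : NonZero m}} → Fin (m ℕ.+ m) → Fin (m ℕ.+ m) → Bool
petersenAdj m j x y with Fin.splitAt m x | Fin.splitAt m y
... | Data.Sum.inj₁ i | Data.Sum.inj₁ i' = eqb i' (i +ₘ 1) ∨ eqb i (i' +ₘ 1)
... | Data.Sum.inj₁ i | Data.Sum.inj₂ i' = eqb i i'
... | Data.Sum.inj₂ i | Data.Sum.inj₁ i' = eqb i i'
... | Data.Sum.inj₂ i | Data.Sum.inj₂ i' = eqb i' (i +ₘ j) ∨ eqb i (i' +ₘ j)

GP : (m j : ℕ) .{{_ : NonZero m}} → Graph
GP m j = record { N = m ℕ.+ m ; adj = petersenAdj m j }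

module Submission where

-- Describe a labelling of G(m,j) by m-periodic f, g (v_x ↦ f x, u_x ↦ g x); its closed sums are
-- S_v(f,g)(x) = f x + f(x+1) + f(x-1) + g x and S_u(f,g)(x) = g x + f x + g(x+j) + g(x-j).
-- Existence: constant labels a, b with 3a + b ≡ a + 3b ≡ 2 (mod n) exist whenever 8 ∤ n, and for
-- even m labels depending only on the parity of x handle odd j, and even j when n ≡ 8 (mod 16).
-- Non-existence: (f,g) ↦ (S_v, S_u) is symmetric for the pairing Σ_x (α x · f x + β x · g x).
-- Pairing the congruences S_v ≡ S_u ≡ 2 (mod n) with weights (α, β) whose image vanishes modulo
-- some d ∣ n gives d ∣ 2 Σ_x (α x + β x). The constant weights α = -1, β = 3 (d = 8) force m to be
-- even, and α = -3, 9, -3, 9, …, β = 1, -3, 1, -3, … (d = 16, m and j even) force 4 ∣ m.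

open import Defs
open import Data.Nat.Base as ℕ using (ℕ; zero; suc; NonZero; _≤_; _<_; _∸_)
import Data.Nat.Properties as ℕ
open import Data.Integer.Base as ℤ using (ℤ; +_; -_; 0ℤ)
import Data.Integer.Properties as ℤ
open import Data.Fin.Base using (Fin; toℕ; _↑ˡ_; _↑ʳ_)
open import Data.Fin.Properties using (toℕ-↑ˡ; toℕ-↑ʳ; toℕ-injective)
open import Data.Bool.Base using (true; false; if_then_else_; _∨_)
open import Data.Empty using (⊥-elim)
open import Data.Product.Base using (∃; _,_; uncurry)
open import Function.Base using (_∘_; case_of_)
open import Relation.Nullary using (¬_)
open import Relation.Binary.PropositionalEquality

module Periodicity where
  open import Data.Nat.Base using (_+_; _*_)
  open import Data.Nat.DivMod using (_%_; _/_; m≡m%n+[m/n]*n)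
  open import Data.Nat.Divisibility using (_∣_; divides; divides-refl; ∣-refl; ∣m∣n⇒∣m+n)
  open import Data.Nat.Tactic.RingSolver using (solve-∀)

  private variable
    A : Set
    a b : A
    p m y : ℕ

  Periodic : (ℕ → A) → ℕ → Set
  Periodic f p = ∀ x → f (x + p) ≡ f x

  periodic-* : {f : ℕ → A} → Periodic f p → ∀ q x → f (x + q * p) ≡ f x
  periodic-* {p = p} {f = f} per zero x = cong f (ℕ.+-identityʳ x)
  periodic-* {p = p} {f = f} per (suc q) x = begin
    f (x + (p + q * p))  ≡⟨ cong f (trans (cong (_+_ x) (ℕ.+-comm p (q * p))) (sym (ℕ.+-assoc x (q * p) p))) ⟩
    f (x + q * p + p)    ≡⟨ per (x + q * p) ⟩
    f (x + q * p)        ≡⟨ periodic-* per q x ⟩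
    f x                  ∎
    where open ≡-Reasoning

  periodic-∣ : {f : ℕ → A} → Periodic f p → p ∣ m → Periodic f m
  periodic-∣ per (divides-refl q) = periodic-* per q

  periodic-% : {f : ℕ → A} .{{_ : NonZero p}} → Periodic f p → ∀ x → f (x % p) ≡ f x
  periodic-% {p = p} {f = f} per x =
    trans (sym (periodic-* per (x / p) (x % p))) (cong f (sym (m≡m%n+[m/n]*n x p)))

  odd-decomposition : ∀ y → ¬ 2 ∣ y → ∃ λ q → y ≡ suc (q * 2)
  odd-decomposition zero ¬2∣y = ⊥-elim (¬2∣y (divides 0 refl))
  odd-decomposition (suc zero) _ = 0 , refl
  odd-decomposition (suc (suc y)) ¬2∣y with odd-decomposition y (¬2∣y ∘ ∣m∣n⇒∣m+n ∣-refl)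
  ... | q , y≡ = suc q , cong (suc ∘ suc) y≡

  alt : A → A → ℕ → A
  alt a b zero    = a
  alt a b (suc x) = alt b a x

  alt-periodic : Periodic (alt a b) 2
  alt-periodic zero    = refl
  alt-periodic (suc x) = alt-periodic x

  alt-even : 2 ∣ y → alt a b y ≡ a
  alt-even (divides-refl q) = periodic-* alt-periodic q 0

  alt-odd : ¬ 2 ∣ y → alt a b y ≡ b
  alt-odd {y = y} ¬2∣y with odd-decomposition y ¬2∣y
  ... | q , refl = periodic-* alt-periodic q 0

  alt-∸ : 2 ∣ m → y ≤ m → alt a b (m ∸ y) ≡ alt a b y
  alt-∸ {m = m} {y = y} {a = a} {b = b} 2∣m y≤m = begin
    alt a b (m ∸ y)            ≡⟨ periodic-* alt-periodic y (m ∸ y) ⟨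
    alt a b (m ∸ y + y * 2)    ≡⟨ cong (alt a b) (trans (reorder (m ∸ y) y) (cong (_+_ y) (ℕ.m∸n+n≡m y≤m))) ⟩
    alt a b (y + m)            ≡⟨ periodic-∣ alt-periodic 2∣m y ⟩
    alt a b y                  ∎
    where
    open ≡-Reasoning
    reorder : ∀ z y → z + y * 2 ≡ y + (z + y)
    reorder = solve-∀

  alt-all : (P : A → Set) → P a → P b → ∀ x → P (alt a b x)
  alt-all P pa pb zero    = pa
  alt-all P pa pb (suc x) = alt-all P pb pa x

open Periodicity

module Sums where
  open import Data.Integer.Base using (_+_; _*_)
  open import Data.Integer.Divisibility.Signed using (_∣_; divides; ∣m∣n⇒∣m+n)
  open import Algebra.Properties.Semiring.Sum ℤ.+-*-semiring
    using (sum-syntax; ∑-distrib-+; sum-cong-≗; sum-replicate-zero)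
  open import Algebra.Properties.AbelianGroup ℤ.+-0-abelianGroup using (∙-cancelʳ)
  open import Data.List.Base as List using (foldr)
  import Data.Fin.Base as Fin
  open import Data.Fin.Properties using (_≟_)
  open import Relation.Nullary using (yes; no)
  open import Data.Integer.Tactic.RingSolver using (solve-∀)

  private variable
    n m p : ℕ
    d : ℤ

  foldr-tabulate : ∀ {A : Set} {n} (f : A → ℤ) (g : Fin n → A) →
                   foldr _+_ 0ℤ (List.map f (List.tabulate g)) ≡ ∑[ i < n ] f (g i)
  foldr-tabulate {n = zero}  f g = refl
  foldr-tabulate {n = suc n} f g = cong (_+_ (f (g Fin.zero))) (foldr-tabulate f (g ∘ Fin.suc))

  ∑-∣ : (f : Fin n → ℤ) → (∀ i → d ∣ f i) → d ∣ ∑[ i < n ] f i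
  ∑-∣ {zero}  f _   = divides 0ℤ refl
  ∑-∣ {suc n} f d∣f = ∣m∣n⇒∣m+n (d∣f _) (∑-∣ (f ∘ Fin.suc) (d∣f ∘ Fin.suc))

  ∑-split : ∀ p q (f : Fin (p ℕ.+ q) → ℤ) →
            ∑[ i < p ℕ.+ q ] f i ≡ ∑[ i < p ] f (i ↑ˡ q) + ∑[ i < q ] f (p ↑ʳ i)
  ∑-split zero    q f = sym (ℤ.+-identityˡ _)
  ∑-split (suc p) q f = trans (cong (_+_ (f Fin.zero)) (∑-split p q (f ∘ Fin.suc)))
                              (sym (ℤ.+-assoc (f Fin.zero) _ _))

  ∑-indicator : ∀ {n} (a : Fin n) (f : Fin n → ℤ) → ∑[ k < n ] (if eqb k a then f k else 0ℤ) ≡ f a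
  ∑-indicator {suc n} Fin.zero    f = trans (cong (_+_ (f Fin.zero)) (sum-replicate-zero n)) (ℤ.+-identityʳ _)
  ∑-indicator {suc n} (Fin.suc a) f = trans (ℤ.+-identityˡ _) (∑-indicator a (f ∘ Fin.suc))

  ∑-indicator₂ : ∀ {n} {a b : Fin n} (f : Fin n → ℤ) → a ≢ b →
                 ∑[ k < n ] (if eqb k a ∨ eqb k b then f k else 0ℤ) ≡ f a + f b
  ∑-indicator₂ {n} {a} {b} f a≢b = begin
    ∑[ k < n ] (if eqb k a ∨ eqb k b then f k else 0ℤ)
      ≡⟨ sum-cong-≗ {n} split ⟩
    ∑[ k < n ] ((if eqb k a then f k else 0ℤ) + (if eqb k b then f k else 0ℤ))
      ≡⟨ ∑-distrib-+ (λ k → if eqb k a then f k else 0ℤ) (λ k → if eqb k b then f k else 0ℤ) ⟩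
    ∑[ k < n ] (if eqb k a then f k else 0ℤ) + ∑[ k < n ] (if eqb k b then f k else 0ℤ)
      ≡⟨ cong₂ _+_ (∑-indicator a f) (∑-indicator b f) ⟩
    f a + f b ∎
    where
    open ≡-Reasoning
    split : ∀ k → (if eqb k a ∨ eqb k b then f k else 0ℤ)
                  ≡ (if eqb k a then f k else 0ℤ) + (if eqb k b then f k else 0ℤ)
    split k with k ≟ a | k ≟ b
    ... | yes refl | yes refl = ⊥-elim (a≢b refl)
    ... | yes _    | no _     = sym (ℤ.+-identityʳ (f k))
    ... | no _     | yes _    = sym (ℤ.+-identityˡ (f k))
    ... | no _     | no _     = refl

  ∑-const : ∀ n c → ∑[ i < n ] c ≡ + n * c
  ∑-const zero    c = sym (ℤ.*-zeroˡ c)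
  ∑-const (suc n) c = trans (cong (_+_ c) (∑-const n c)) (sym (ℤ.suc-* (+ n) c))

  ∑-periodic : {F : ℕ → ℤ} → Periodic F p → ∀ h →
               ∑[ i < h ℕ.* p ] F (toℕ i) ≡ + h * ∑[ i < p ] F (toℕ i)
  ∑-periodic {p = p} {F = F} per zero = sym (ℤ.*-zeroˡ (∑[ i < p ] F (toℕ i)))
  ∑-periodic {p = p} {F = F} per (suc h) = begin
    ∑[ i < p ℕ.+ h ℕ.* p ] F (toℕ i)
      ≡⟨ ∑-split p (h ℕ.* p) _ ⟩
    ∑[ i < p ] F (toℕ (i ↑ˡ (h ℕ.* p))) + ∑[ i < h ℕ.* p ] F (toℕ (p ↑ʳ i))
      ≡⟨ cong₂ _+_ (sum-cong-≗ {p} λ i → cong F (toℕ-↑ˡ i (h ℕ.* p))) (sum-cong-≗ {h ℕ.* p} shifted) ⟩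
    S + ∑[ i < h ℕ.* p ] F (toℕ i)
      ≡⟨ cong (_+_ S) (∑-periodic per h) ⟩
    S + + h * S
      ≡⟨ ℤ.suc-* (+ h) S ⟨
    + suc h * S ∎
    where
    open ≡-Reasoning
    S = ∑[ i < p ] F (toℕ i)
    shifted : ∀ i → F (toℕ (p ↑ʳ i)) ≡ F (toℕ i)
    shifted i = trans (cong F (trans (toℕ-↑ʳ p i) (ℕ.+-comm p (toℕ i)))) (per (toℕ i))

  ∑-rotate₁ : {F : ℕ → ℤ} → Periodic F m → ∑[ i < m ] F (suc (toℕ i)) ≡ ∑[ i < m ] F (toℕ i)
  ∑-rotate₁ {m} {F} per =
    ∙-cancelʳ (F 0) _ _ (trans (telescope m F) (cong (_+_ (∑[ i < m ] F (toℕ i))) (per 0)))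
    where
    telescope : ∀ n (F : ℕ → ℤ) → ∑[ i < n ] F (suc (toℕ i)) + F 0 ≡ ∑[ i < n ] F (toℕ i) + F n
    telescope zero    F = refl
    telescope (suc n) F = begin
      (F 1 + S₂) + F 0 ≡⟨ rearrange (F 0) (F 1) S₂ ⟩
      F 0 + (S₂ + F 1) ≡⟨ cong (_+_ (F 0)) (telescope n (F ∘ suc)) ⟩
      F 0 + (S₁ + F (suc n)) ≡⟨ ℤ.+-assoc (F 0) S₁ (F (suc n)) ⟨
      (F 0 + S₁) + F (suc n) ∎
      where
      open ≡-Reasoning
      S₁ = ∑[ i < n ] F (suc (toℕ i))
      S₂ = ∑[ i < n ] F (suc (suc (toℕ i)))
      rearrange : ∀ a b s → (b + s) + a ≡ a + (s + b)
      rearrange = solve-∀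

  ∑-rotate : {F : ℕ → ℤ} → Periodic F m → ∀ a → ∑[ i < m ] F (toℕ i ℕ.+ a) ≡ ∑[ i < m ] F (toℕ i)
  ∑-rotate {m} {F} per zero = sum-cong-≗ {m} (λ i → cong F (ℕ.+-identityʳ (toℕ i)))
  ∑-rotate {m} {F} per (suc a) = begin
    ∑[ i < m ] F (toℕ i ℕ.+ suc a)    ≡⟨ sum-cong-≗ {m} (λ i → cong F (ℕ.+-suc (toℕ i) a)) ⟩
    ∑[ i < m ] F (suc (toℕ i) ℕ.+ a)  ≡⟨ ∑-rotate₁ {F = λ x → F (x ℕ.+ a)} shifted ⟩
    ∑[ i < m ] F (toℕ i ℕ.+ a)        ≡⟨ ∑-rotate per a ⟩
    ∑[ i < m ] F (toℕ i)              ∎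
    where
    open ≡-Reasoning
    shifted : Periodic (λ x → F (x ℕ.+ a)) m
    shifted x = trans (cong F (trans (ℕ.+-assoc x m a)
                                     (trans (cong (ℕ._+_ x) (ℕ.+-comm m a)) (sym (ℕ.+-assoc x a m)))))
                      (per (x ℕ.+ a))

open Sums

quotient-unique : ∀ {n r₁ r₂ a b} .{{_ : NonZero n}} → r₁ < n → r₂ < n →
                  r₁ ℕ.+ n ℕ.* a ≡ r₂ ℕ.+ n ℕ.* b → a ≡ b
quotient-unique {n} {r₁} {r₂} {a} {b} r₁<n r₂<n eq =
  ℕ.*-cancelˡ-≡ a b n (ℕ.+-cancelˡ-≡ r₁ _ _ (trans eq (cong (λ r → r ℕ.+ n ℕ.* b) (sym r₁≡r₂))))
  where
  open import Data.Nat.DivMod using (_%_; m<n⇒m%n≡m; %-remove-+ʳ)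
  open import Data.Nat.Divisibility using (m∣m*n)
  open ≡-Reasoning
  r₁≡r₂ : r₁ ≡ r₂
  r₁≡r₂ = begin
    r₁                      ≡⟨ m<n⇒m%n≡m r₁<n ⟨
    r₁ % n                  ≡⟨ %-remove-+ʳ r₁ (m∣m*n a) ⟨
    (r₁ ℕ.+ n ℕ.* a) % n    ≡⟨ cong (_% n) eq ⟩
    (r₂ ℕ.+ n ℕ.* b) % n    ≡⟨ %-remove-+ʳ r₂ (m∣m*n b) ⟩
    r₂ % n                  ≡⟨ m<n⇒m%n≡m r₂<n ⟩
    r₂                      ∎

module ClosedColorings (G : Graph) where
  open import Data.Integer.Base using (_+_; _*_; _-_)
  open import Data.Integer.DivMod using (_%ℕ_; _/ℕ_; a≡a%ℕn+[a/ℕn]*n; n%ℕd<d)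
  open import Data.Integer.Divisibility.Signed using (_∣_; divides; ∣m∣n⇒∣m+n; ∣ᵤ⇒∣; ∣⇒∣ᵤ)
  open import Algebra.Properties.Semiring.Sum ℤ.+-*-semiring using (sum-syntax; ∑-distrib-+; sum-cong-≗)
  open import Algebra.Properties.CommutativeSemigroup ℤ.+-commutativeSemigroup using (interchange)
  open import Data.Integer.Tactic.RingSolver using (solve-∀)
  open import Function.Base using (id)

  private variable
    n : ℕ
    d k : ℤ
    c f g h : Fin (N G) → ℤ

  Loopless : Set
  Loopless = ∀ v → adj G v v ≡ false

  closedSum-∑ : ∀ ℓ v → closedSum G ℓ v ≡ ℓ v + ∑[ w < N G ] (if adj G v w then ℓ w else 0ℤ)
  closedSum-∑ ℓ v = cong (_+_ (ℓ v)) (foldr-tabulate (λ w → if adj G v w then ℓ w else 0ℤ) id)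

  closedSum-+ : ∀ f g → (∀ w → h w ≡ f w + g w) → ∀ v →
                closedSum G h v ≡ closedSum G f v + closedSum G g v
  closedSum-+ {h} f g h≡f+g v = begin
    closedSum G h v
      ≡⟨ closedSum-∑ h v ⟩
    h v + ∑[ w < N G ] masked h w
      ≡⟨ cong₂ _+_ (h≡f+g v) (trans (sum-cong-≗ masked-+) (∑-distrib-+ (masked f) (masked g))) ⟩
    (f v + g v) + (∑[ w < N G ] masked f w + ∑[ w < N G ] masked g w)
      ≡⟨ interchange (f v) (g v) _ _ ⟩
    (f v + ∑[ w < N G ] masked f w) + (g v + ∑[ w < N G ] masked g w)
      ≡⟨ cong₂ _+_ (closedSum-∑ f v) (closedSum-∑ g v) ⟨
    closedSum G f v + closedSum G g v ∎
    where
    open ≡-Reasoning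
    masked : (Fin (N G) → ℤ) → Fin (N G) → ℤ
    masked ℓ w = if adj G v w then ℓ w else 0ℤ
    masked-+ : ∀ w → masked h w ≡ masked f w + masked g w
    masked-+ w with adj G v w
    ... | true  = h≡f+g w
    ... | false = refl

  closedSum-∣ : (∀ w → d ∣ f w) → ∀ v → d ∣ closedSum G f v
  closedSum-∣ {d} {f} d∣f v =
    subst (d ∣_) (sym (closedSum-∑ f v)) (∣m∣n⇒∣m+n (d∣f v) (∑-∣ _ λ w → masked (adj G v w) w))
    where
    masked : ∀ b w → d ∣ (if b then f w else 0ℤ)
    masked true  w = d∣f w
    masked false w = divides 0ℤ refl

  closedColoring-cong : {ℓ : Fin (N G) → ℤ} → (∀ v → + n ∣ ℓ v - c v) →
                        ClosedColoring G n k c → ClosedColoring G n k ℓ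
  closedColoring-cong {n} {c} {k} {ℓ} n∣ℓ-c cc v = ∣⇒∣ᵤ (subst (+ n ∣_) (sym shift) n∣sum)
    where
    split : closedSum G ℓ v ≡ closedSum G c v + closedSum G (λ w → ℓ w - c w) v
    split = closedSum-+ c (λ w → ℓ w - c w) (λ w → sym (add-diff (c w) (ℓ w))) v
      where
      add-diff : ∀ x y → x + (y - x) ≡ y
      add-diff = solve-∀
    shift : closedSum G ℓ v - k ≡ (closedSum G c v - k) + closedSum G (λ w → ℓ w - c w) v
    shift = trans (cong (_- k) split) (reorder (closedSum G c v) (closedSum G (λ w → ℓ w - c w) v) k)
      where
      reorder : ∀ x y z → (x + y) - z ≡ (x - z) + y
      reorder = solve-∀
    n∣sum : + n ∣ (closedSum G c v - k) + closedSum G (λ w → ℓ w - c w) v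
    n∣sum = ∣m∣n⇒∣m+n {m = closedSum G c v - k} (∣ᵤ⇒∣ (cc v)) (closedSum-∣ n∣ℓ-c v)

  chiExists-of-closedColoring : .{{_ : NonZero n}} → Loopless → ClosedColoring G n k c → ChiExists G n k
  chiExists-of-closedColoring {n} {k} {c} loopless cc =
    ℓ , proper , closedColoring-cong {c = c} {ℓ = ℓ} n∣ℓ-c cc
    where
    -- Reducing c mod n and adding n·(index of v) keeps all closed sums mod n and separates all labels.
    ℓ : Fin (N G) → ℤ
    ℓ v = + (c v %ℕ n ℕ.+ n ℕ.* toℕ v)
    proper : Proper G ℓ
    proper v w v~w ℓv≡ℓw
      with toℕ-injective (quotient-unique (n%ℕd<d (c v) n) (n%ℕd<d (c w) n) (ℤ.+-injective ℓv≡ℓw))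
    ... | refl = case trans (sym v~w) (loopless v) of λ ()
    n∣ℓ-c : ∀ v → + n ∣ ℓ v - c v
    n∣ℓ-c v = divides (+ toℕ v - c v /ℕ n) (begin
      ℓ v - c v
        ≡⟨ cong₂ _-_ (cong (_+_ (+ r)) (ℤ.pos-* n (toℕ v))) (a≡a%ℕn+[a/ℕn]*n (c v) n) ⟩
      (+ r + + n * + toℕ v) - (+ r + c v /ℕ n * + n)
        ≡⟨ regroup (+ r) (+ n) (+ toℕ v) (c v /ℕ n) ⟩
      (+ toℕ v - c v /ℕ n) * + n ∎)
      where
      open ≡-Reasoning
      r = c v %ℕ n
      regroup : ∀ r n t q → (r + n * t) - (r + q * n) ≡ (t - q) * n
      regroup = solve-∀

module Residues (m : ℕ) .{{_ : NonZero m}} where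
  open import Data.Nat.Base using (_+_; _*_)
  open import Data.Nat.DivMod using (_%_; _/_; m%n<n; m<n⇒m%n≡m; [m+n]%n≡m%n; [m+kn]%n≡m%n; m≡m%n+[m/n]*n)
  open import Data.Nat.Divisibility using (_∣_; divides; ∣⇒≤)
  open import Data.Fin.Base using (fromℕ<)
  open import Data.Fin.Properties using (toℕ-fromℕ<; toℕ<n; _≟_)
  open import Data.Sum.Base using (inj₁; inj₂)
  open import Data.Nat.Tactic.RingSolver using (solve-∀)
  open import Function.Bundles using (mk⇔)
  open import Relation.Nullary.Decidable using (does-⇔)
  open ≡-Reasoning

  private variable
    a b x y : ℕ

  residue : ℕ → Fin m
  residue x = fromℕ< (m%n<n x m)

  toℕ-residue : ∀ x → toℕ (residue x) ≡ x % m
  toℕ-residue x = toℕ-fromℕ< (m%n<n x m)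

  residue-toℕ : ∀ i → residue (toℕ i) ≡ i
  residue-toℕ i = toℕ-injective (trans (toℕ-residue (toℕ i)) (m<n⇒m%n≡m (toℕ<n i)))

  residue-periodic : Periodic residue m
  residue-periodic x = toℕ-injective (begin
    toℕ (residue (x + m))  ≡⟨ toℕ-residue (x + m) ⟩
    (x + m) % m            ≡⟨ [m+n]%n≡m%n x m ⟩
    x % m                  ≡⟨ toℕ-residue x ⟨
    toℕ (residue x)        ∎)

  %-absorbˡ : ∀ x y → (x % m + y) % m ≡ (x + y) % m
  %-absorbˡ x y = begin
    (x % m + y) % m                ≡⟨ [m+kn]%n≡m%n (x % m + y) (x / m) m ⟨
    (x % m + y + x / m * m) % m    ≡⟨ cong (_% m) (reorder (x % m) y (x / m * m)) ⟩
    (x % m + x / m * m + y) % m    ≡⟨ cong (λ z → (z + y) % m) (m≡m%n+[m/n]*n x m) ⟨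
    (x + y) % m                    ∎
    where
    reorder : ∀ r y q → r + y + q ≡ r + q + y
    reorder = solve-∀

  %-≡⇒∣∸ : x % m ≡ y % m → m ∣ y ∸ x
  %-≡⇒∣∸ {x} {y} eq = divides (y / m ∸ x / m) (begin
    y ∸ x                                    ≡⟨ cong₂ _∸_ (m≡m%n+[m/n]*n y m) (m≡m%n+[m/n]*n x m) ⟩
    (y % m + y / m * m) ∸ (x % m + x / m * m) ≡⟨ cong (λ r → (r + y / m * m) ∸ (x % m + x / m * m)) eq ⟨
    (x % m + y / m * m) ∸ (x % m + x / m * m) ≡⟨ ℕ.[m+n]∸[m+o]≡n∸o (x % m) (y / m * m) (x / m * m) ⟩
    y / m * m ∸ x / m * m                    ≡⟨ ℕ.*-distribʳ-∸ m (y / m) (x / m) ⟨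
    (y / m ∸ x / m) * m                      ∎)

  +ₘ-assoc : ∀ i a b → (i +ₘ a) +ₘ b ≡ i +ₘ (a + b)
  +ₘ-assoc i a b = toℕ-injective (begin
    toℕ ((i +ₘ a) +ₘ b)           ≡⟨ toℕ-residue (toℕ (i +ₘ a) + b) ⟩
    (toℕ (i +ₘ a) + b) % m        ≡⟨ cong (λ t → (t + b) % m) (toℕ-residue (toℕ i + a)) ⟩
    ((toℕ i + a) % m + b) % m     ≡⟨ %-absorbˡ (toℕ i + a) b ⟩
    (toℕ i + a + b) % m           ≡⟨ cong (_% m) (ℕ.+-assoc (toℕ i) a b) ⟩
    (toℕ i + (a + b)) % m         ≡⟨ toℕ-residue (toℕ i + (a + b)) ⟨
    toℕ (i +ₘ (a + b))            ∎)

  +ₘ-identityʳ : ∀ i → i +ₘ 0 ≡ i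
  +ₘ-identityʳ i = trans (cong residue (ℕ.+-identityʳ (toℕ i))) (residue-toℕ i)

  +ₘ-inverse : ∀ i → a ≤ m → (i +ₘ a) +ₘ (m ∸ a) ≡ i
  +ₘ-inverse {a} i a≤m = begin
    (i +ₘ a) +ₘ (m ∸ a)     ≡⟨ +ₘ-assoc i a (m ∸ a) ⟩
    i +ₘ (a + (m ∸ a))      ≡⟨ cong (i +ₘ_) (ℕ.m+[n∸m]≡n a≤m) ⟩
    residue (toℕ i + m)     ≡⟨ residue-periodic (toℕ i) ⟩
    residue (toℕ i)         ≡⟨ residue-toℕ i ⟩
    i                       ∎

  +ₘ-inverse′ : ∀ i → a ≤ m → (i +ₘ (m ∸ a)) +ₘ a ≡ i
  +ₘ-inverse′ {a} i a≤m =
    subst (λ b → (i +ₘ (m ∸ a)) +ₘ b ≡ i) (ℕ.m∸[m∸n]≡n a≤m) (+ₘ-inverse i (ℕ.m∸n≤m m a))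

  ∣-<⇒≡0 : ∀ {d} → d < m → m ∣ d → d ≡ 0
  ∣-<⇒≡0 {zero}  _   _   = refl
  ∣-<⇒≡0 {suc d} d<m m∣d = ⊥-elim (ℕ.<⇒≱ d<m (∣⇒≤ m∣d))

  +ₘ-cancelˡ-≤ : ∀ i → a ≤ b → b < m → i +ₘ a ≡ i +ₘ b → a ≡ b
  +ₘ-cancelˡ-≤ {a} {b} i a≤b b<m eq =
    ℕ.≤-antisym a≤b (ℕ.m∸n≡0⇒m≤n (∣-<⇒≡0 (ℕ.≤-<-trans (ℕ.m∸n≤m b a) b<m) m∣b∸a))
    where
    m∣b∸a : m ∣ b ∸ a
    m∣b∸a = subst (m ∣_) (ℕ.[m+n]∸[m+o]≡n∸o (toℕ i) b a)
              (%-≡⇒∣∸ (trans (sym (toℕ-residue (toℕ i + a)))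
                              (trans (cong toℕ eq) (toℕ-residue (toℕ i + b)))))

  +ₘ-cancelˡ : ∀ i → a < m → b < m → i +ₘ a ≡ i +ₘ b → a ≡ b
  +ₘ-cancelˡ {a} {b} i a<m b<m eq with ℕ.≤-total a b
  ... | inj₁ a≤b = +ₘ-cancelˡ-≤ i a≤b b<m eq
  ... | inj₂ b≤a = sym (+ₘ-cancelˡ-≤ i b≤a a<m (sym eq))

  eqb-sym : ∀ (i i′ : Fin m) → eqb i i′ ≡ eqb i′ i
  eqb-sym i i′ = does-⇔ (mk⇔ sym sym) (i ≟ i′) (i′ ≟ i)

  eqb-swap : ∀ (i i′ : Fin m) → a ≤ m → eqb i (i′ +ₘ a) ≡ eqb i′ (i +ₘ (m ∸ a))
  eqb-swap {a} i i′ a≤m = does-⇔ (mk⇔ to from) (i ≟ i′ +ₘ a) (i′ ≟ i +ₘ (m ∸ a))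
    where
    to : i ≡ i′ +ₘ a → i′ ≡ i +ₘ (m ∸ a)
    to refl = sym (+ₘ-inverse i′ a≤m)
    from : i′ ≡ i +ₘ (m ∸ a) → i ≡ i′ +ₘ a
    from refl = sym (+ₘ-inverse′ i a≤m)

module Petersen (m j : ℕ) .{{_ : NonZero m}} (3≤m : 3 ≤ m) (1≤j : 1 ≤ j) (2j<m : 2 ℕ.* j < m) where
  open import Data.Integer.Base using (_+_; _*_; _-_)
  open import Data.Integer.Divisibility.Signed
    using (_∣_; divides; ∣-trans; ∣m∣n⇒∣m+n; ∣m+n∣m⇒∣n; ∣m⇒∣m*n; ∣n⇒∣m*n; ∣ᵤ⇒∣; ∣⇒∣ᵤ)
  open import Algebra.Properties.Semiring.Sum ℤ.+-*-semiring using (sum-syntax; ∑-distrib-+; sum-cong-≗)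
  open import Data.Integer.Tactic.RingSolver using (solve-∀)
  import Data.Nat.Divisibility as ℕ
  open import Data.Fin.Base using (splitAt)
  open import Data.Fin.Properties using (splitAt-↑ˡ; splitAt-↑ʳ; splitAt⁻¹-↑ˡ; splitAt⁻¹-↑ʳ; _≟_)
  open import Data.Sum.Base using (inj₁; inj₂; [_,_]′)
  open import Data.Bool.Properties using (∨-idem)
  open import Relation.Nullary.Decidable using (dec-false)
  open Residues m
  open ClosedColorings (GP m j)
  open ≡-Reasoning

  private variable
    n : ℕ
    k d a₀ a₁ b₀ b₁ : ℤ
    f g α β : ℕ → ℤ

  private
    1≤m : 1 ≤ m
    1≤m = ℕ.≤-trans (ℕ.s≤s ℕ.z≤n) 3≤m
    j≤m : j ≤ m
    j≤m = ℕ.≤-trans (ℕ.m≤m+n j (j ℕ.+ 0)) (ℕ.<⇒≤ 2j<m)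
    1<m : 1 < m
    1<m = ℕ.≤-trans (ℕ.s≤s (ℕ.s≤s ℕ.z≤n)) 3≤m
    j<m : j < m
    j<m = ℕ.≤-trans (ℕ.s≤s (ℕ.m≤m+n j (j ℕ.+ 0))) 2j<m

  outer inner : Fin m → Fin (m ℕ.+ m)
  outer i = i ↑ˡ m
  inner i = m ↑ʳ i

  vertex-elim : (P : Fin (m ℕ.+ m) → Set) → (∀ i → P (outer i)) → (∀ i → P (inner i)) → ∀ v → P v
  vertex-elim P Pᵛ Pᵘ v with splitAt m v in eq
  ... | inj₁ i = subst P (splitAt⁻¹-↑ˡ eq) (Pᵛ i)
  ... | inj₂ i = subst P (splitAt⁻¹-↑ʳ eq) (Pᵘ i)

  adj-outer-outer : ∀ i i′ → petersenAdj m j (outer i) (outer i′) ≡ (eqb i′ (i +ₘ 1) ∨ eqb i (i′ +ₘ 1))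
  adj-outer-outer i i′ rewrite splitAt-↑ˡ m i m | splitAt-↑ˡ m i′ m = refl

  adj-outer-inner : ∀ i i′ → petersenAdj m j (outer i) (inner i′) ≡ eqb i i′
  adj-outer-inner i i′ rewrite splitAt-↑ˡ m i m | splitAt-↑ʳ m m i′ = refl

  adj-inner-outer : ∀ i i′ → petersenAdj m j (inner i) (outer i′) ≡ eqb i i′
  adj-inner-outer i i′ rewrite splitAt-↑ʳ m m i | splitAt-↑ˡ m i′ m = refl

  adj-inner-inner : ∀ i i′ → petersenAdj m j (inner i) (inner i′) ≡ (eqb i′ (i +ₘ j) ∨ eqb i (i′ +ₘ j))
  adj-inner-inner i i′ rewrite splitAt-↑ʳ m m i | splitAt-↑ʳ m m i′ = refl

  loopless : Loopless
  loopless = vertex-elim _ (λ i → trans (adj-outer-outer i i) (no-loop i 1 ℕ.z<s 1<m))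
                          (λ i → trans (adj-inner-inner i i) (no-loop i j 1≤j j<m))
    where
    no-loop : ∀ i a → 0 < a → a < m → (eqb i (i +ₘ a) ∨ eqb i (i +ₘ a)) ≡ false
    no-loop i a 0<a a<m = trans (∨-idem (eqb i (i +ₘ a)))
      (dec-false (i ≟ i +ₘ a) λ i≡i+a →
        ℕ.<⇒≢ 0<a (+ₘ-cancelˡ i (ℕ.<-trans 0<a a<m) a<m (trans (+ₘ-identityʳ i) i≡i+a)))

  -- For m-periodic f, g these are the closed sums at v_x and u_x of the labelling v_x ↦ f x, u_x ↦ g x;
  -- the offset m ∸ a stands for -a.
  shift± : ℕ → (ℕ → ℤ) → ℕ → ℤ
  shift± a f x = f (x ℕ.+ a) + f (x ℕ.+ (m ∸ a))

  closedSumᵛ closedSumᵘ : (ℕ → ℤ) → (ℕ → ℤ) → ℕ → ℤ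
  closedSumᵛ f g x = f x + (shift± 1 f x + g x)
  closedSumᵘ f g x = g x + (f x + shift± j g x)

  private
    j+j<m : j ℕ.+ j < m
    j+j<m = subst (λ z → j ℕ.+ z < m) (ℕ.+-identityʳ j) 2j<m

  opposite-distinct : ∀ i a → 0 < a → a ℕ.+ a < m → i +ₘ a ≢ i +ₘ (m ∸ a)
  opposite-distinct i a 0<a a+a<m eq =
    ℕ.<⇒≢ a+a<m (trans (cong (ℕ._+_ a) (+ₘ-cancelˡ i a<m m∸a<m eq)) (ℕ.m+[n∸m]≡n (ℕ.<⇒≤ a<m)))
    where
    a<m : a < m
    a<m = ℕ.<-≤-trans (ℕ.m<m+n a 0<a) (ℕ.<⇒≤ a+a<m)
    m∸a<m : m ∸ a < m
    m∸a<m = ℕ.∸-monoʳ-< {m} {a} {0} 0<a (ℕ.<⇒≤ a<m)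

  outer-neighbours : ∀ (ℓ : Fin (m ℕ.+ m) → ℤ) i →
    ∑[ w < m ℕ.+ m ] (if petersenAdj m j (outer i) w then ℓ w else 0ℤ)
      ≡ (ℓ (outer (i +ₘ 1)) + ℓ (outer (i +ₘ (m ∸ 1)))) + ℓ (inner i)
  outer-neighbours ℓ i = trans (∑-split m m _) (cong₂ _+_ rim spoke)
    where
    rim : ∑[ i′ < m ] (if petersenAdj m j (outer i) (outer i′) then ℓ (outer i′) else 0ℤ)
            ≡ ℓ (outer (i +ₘ 1)) + ℓ (outer (i +ₘ (m ∸ 1)))
    rim = trans (sum-cong-≗ {m} λ i′ → cong (λ b → if b then ℓ (outer i′) else 0ℤ)
                   (trans (adj-outer-outer i i′) (cong (_∨_ (eqb i′ (i +ₘ 1))) (eqb-swap i i′ 1≤m))))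
                (∑-indicator₂ (ℓ ∘ outer) (opposite-distinct i 1 ℕ.z<s 3≤m))
    spoke : ∑[ i′ < m ] (if petersenAdj m j (outer i) (inner i′) then ℓ (inner i′) else 0ℤ) ≡ ℓ (inner i)
    spoke = trans (sum-cong-≗ {m} λ i′ → cong (λ b → if b then ℓ (inner i′) else 0ℤ)
                     (trans (adj-outer-inner i i′) (eqb-sym i i′)))
                  (∑-indicator i (ℓ ∘ inner))

  inner-neighbours : ∀ (ℓ : Fin (m ℕ.+ m) → ℤ) i →
    ∑[ w < m ℕ.+ m ] (if petersenAdj m j (inner i) w then ℓ w else 0ℤ)
      ≡ ℓ (outer i) + (ℓ (inner (i +ₘ j)) + ℓ (inner (i +ₘ (m ∸ j))))
  inner-neighbours ℓ i = trans (∑-split m m _) (cong₂ _+_ spoke rim)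
    where
    spoke : ∑[ i′ < m ] (if petersenAdj m j (inner i) (outer i′) then ℓ (outer i′) else 0ℤ) ≡ ℓ (outer i)
    spoke = trans (sum-cong-≗ {m} λ i′ → cong (λ b → if b then ℓ (outer i′) else 0ℤ)
                     (trans (adj-inner-outer i i′) (eqb-sym i i′)))
                  (∑-indicator i (ℓ ∘ outer))
    rim : ∑[ i′ < m ] (if petersenAdj m j (inner i) (inner i′) then ℓ (inner i′) else 0ℤ)
            ≡ ℓ (inner (i +ₘ j)) + ℓ (inner (i +ₘ (m ∸ j)))
    rim = trans (sum-cong-≗ {m} λ i′ → cong (λ b → if b then ℓ (inner i′) else 0ℤ)
                   (trans (adj-inner-inner i i′) (cong (_∨_ (eqb i′ (i +ₘ j))) (eqb-swap i i′ j≤m))))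
                (∑-indicator₂ (ℓ ∘ inner) (opposite-distinct i j 1≤j j+j<m))

  module _ {ℓ : Fin (m ℕ.+ m) → ℤ} {f g : ℕ → ℤ}
           (ℓᵛ : ∀ x → ℓ (outer (residue x)) ≡ f x) (ℓᵘ : ∀ x → ℓ (inner (residue x)) ≡ g x) where

    private
      at : ∀ {h : ℕ → ℤ} (σ : Fin m → Fin (m ℕ.+ m)) →
           (∀ x → ℓ (σ (residue x)) ≡ h x) → ∀ i → ℓ (σ i) ≡ h (toℕ i)
      at σ ℓσ i = trans (cong (ℓ ∘ σ) (sym (residue-toℕ i))) (ℓσ (toℕ i))

    closedSum-outer : ∀ i → closedSum (GP m j) ℓ (outer i) ≡ closedSumᵛ f g (toℕ i)
    closedSum-outer i = begin
      closedSum (GP m j) ℓ (outer i)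
        ≡⟨ closedSum-∑ ℓ (outer i) ⟩
      ℓ (outer i) + ∑[ w < m ℕ.+ m ] (if petersenAdj m j (outer i) w then ℓ w else 0ℤ)
        ≡⟨ cong (_+_ (ℓ (outer i))) (outer-neighbours ℓ i) ⟩
      ℓ (outer i) + ((ℓ (outer (i +ₘ 1)) + ℓ (outer (i +ₘ (m ∸ 1)))) + ℓ (inner i))
        ≡⟨ cong₂ _+_ (at outer ℓᵛ i) (cong₂ _+_ (cong₂ _+_ (ℓᵛ _) (ℓᵛ _)) (at inner ℓᵘ i)) ⟩
      closedSumᵛ f g (toℕ i) ∎

    closedSum-inner : ∀ i → closedSum (GP m j) ℓ (inner i) ≡ closedSumᵘ f g (toℕ i)
    closedSum-inner i = begin
      closedSum (GP m j) ℓ (inner i)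
        ≡⟨ closedSum-∑ ℓ (inner i) ⟩
      ℓ (inner i) + ∑[ w < m ℕ.+ m ] (if petersenAdj m j (inner i) w then ℓ w else 0ℤ)
        ≡⟨ cong (_+_ (ℓ (inner i))) (inner-neighbours ℓ i) ⟩
      ℓ (inner i) + (ℓ (outer i) + (ℓ (inner (i +ₘ j)) + ℓ (inner (i +ₘ (m ∸ j)))))
        ≡⟨ cong₂ _+_ (at inner ℓᵘ i) (cong₂ _+_ (at outer ℓᵛ i) (cong₂ _+_ (ℓᵘ _) (ℓᵘ _))) ⟩
      closedSumᵘ f g (toℕ i) ∎

  labelling : (ℕ → ℤ) → (ℕ → ℤ) → Fin (m ℕ.+ m) → ℤ
  labelling f g v = [ f ∘ toℕ , g ∘ toℕ ]′ (splitAt m v)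

  chiExists-of-periodic : .{{_ : NonZero n}} → Periodic f m → Periodic g m →
    (∀ x → + n ∣ closedSumᵛ f g x - k) → (∀ x → + n ∣ closedSumᵘ f g x - k) → ChiExists (GP m j) n k
  chiExists-of-periodic {n} {f} {g} {k} f-per g-per n∣Sᵛ n∣Sᵘ =
    chiExists-of-closedColoring {c = ℓ} loopless
      (vertex-elim P (λ i → coloured (closedSum-outer {ℓ = ℓ} ℓᵛ ℓᵘ i) (n∣Sᵛ (toℕ i)))
                     (λ i → coloured (closedSum-inner {ℓ = ℓ} ℓᵛ ℓᵘ i) (n∣Sᵘ (toℕ i))))
    where
    ℓ : Fin (m ℕ.+ m) → ℤ
    ℓ = labelling f g
    P : Fin (m ℕ.+ m) → Set
    P v = ℤ.+ n ∣ᵤ closedSum (GP m j) ℓ v - k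
      where open import Data.Integer.Divisibility renaming (_∣_ to _∣ᵤ_)
    coloured : ∀ {v s} → closedSum (GP m j) ℓ v ≡ s → + n ∣ s - k → P v
    coloured eq n∣s = ∣⇒∣ᵤ (subst (λ s → + n ∣ s - k) (sym eq) n∣s)
    ℓᵛ : ∀ x → ℓ (outer (residue x)) ≡ f x
    ℓᵛ x = trans (cong [ f ∘ toℕ , g ∘ toℕ ]′ (splitAt-↑ˡ m (residue x) m))
                 (trans (cong f (toℕ-residue x)) (periodic-% f-per x))
    ℓᵘ : ∀ x → ℓ (inner (residue x)) ≡ g x
    ℓᵘ x = trans (cong [ f ∘ toℕ , g ∘ toℕ ]′ (splitAt-↑ʳ m m (residue x)))
                 (trans (cong g (toℕ-residue x)) (periodic-% g-per x))

  chiExists-constant : .{{_ : NonZero n}} → ∀ a b →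
    + n ∣ a + ((a + a) + b) - k → + n ∣ b + (a + (b + b)) - k → ChiExists (GP m j) n k
  chiExists-constant a b n∣Sᵛ n∣Sᵘ =
    chiExists-of-periodic {f = λ _ → a} {g = λ _ → b} (λ _ → refl) (λ _ → refl)
                          (λ _ → n∣Sᵛ) (λ _ → n∣Sᵘ)

  closedSumᵛ-alt : ℕ._∣_ 2 m → ∀ x →
    closedSumᵛ (alt a₀ a₁) (alt b₀ b₁) x ≡ alt (a₀ + ((a₁ + a₁) + b₀)) (a₁ + ((a₀ + a₀) + b₁)) x
  closedSumᵛ-alt {a₀ = a₀} {a₁} {b₀} {b₁} 2∣m zero =
    cong (λ z → a₀ + ((a₁ + z) + b₀)) (alt-∸ 2∣m 1≤m)
  closedSumᵛ-alt {a₀ = a₀} {a₁} {b₀} {b₁} 2∣m (suc x) = closedSumᵛ-alt {a₀ = a₁} {a₀} {b₁} {b₀} 2∣m x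

  closedSumᵘ-alt : ∀ {c₀ c₁} → ℕ._∣_ 2 m → alt b₀ b₁ j ≡ c₀ → alt b₁ b₀ j ≡ c₁ → ∀ x →
    closedSumᵘ (alt a₀ a₁) (alt b₀ b₁) x ≡ alt (b₀ + (a₀ + (c₀ + c₀))) (b₁ + (a₁ + (c₁ + c₁))) x
  closedSumᵘ-alt {b₀ = b₀} {b₁} {a₀ = a₀} {a₁} 2∣m refl _ zero =
    cong (λ z → b₀ + (a₀ + (alt b₀ b₁ j + z))) (alt-∸ 2∣m j≤m)
  closedSumᵘ-alt {b₀ = b₀} {b₁} {a₀ = a₀} {a₁} 2∣m c₀ c₁ (suc x) =
    closedSumᵘ-alt {b₀ = b₁} {b₀} {a₀ = a₁} {a₀} 2∣m c₁ c₀ x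

  chiExists-alternating : .{{_ : NonZero n}} → ℕ._∣_ 2 m → ∀ a₀ a₁ b₀ b₁ {c₀ c₁} →
    alt b₀ b₁ j ≡ c₀ → alt b₁ b₀ j ≡ c₁ →
    + n ∣ a₀ + ((a₁ + a₁) + b₀) - k → + n ∣ a₁ + ((a₀ + a₀) + b₁) - k →
    + n ∣ b₀ + (a₀ + (c₀ + c₀)) - k → + n ∣ b₁ + (a₁ + (c₁ + c₁)) - k →
    ChiExists (GP m j) n k
  chiExists-alternating {n} {k} 2∣m a₀ a₁ b₀ b₁ c₀ c₁ v₀ v₁ u₀ u₁ =
    chiExists-of-periodic {f = alt a₀ a₁} {g = alt b₀ b₁}
      (periodic-∣ alt-periodic 2∣m) (periodic-∣ alt-periodic 2∣m)
      (λ x → subst P (sym (closedSumᵛ-alt {a₀ = a₀} {a₁} {b₀} {b₁} 2∣m x)) (alt-all P v₀ v₁ x))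
      (λ x → subst P (sym (closedSumᵘ-alt {b₀ = b₀} {b₁} {a₀ = a₀} {a₁} 2∣m c₀ c₁ x)) (alt-all P u₀ u₁ x))
    where
    P : ℤ → Set
    P s = + n ∣ s - k

  ⟨_,_⟩ : (ℕ → ℤ) → (ℕ → ℤ) → ℤ
  ⟨ α , f ⟩ = ∑[ i < m ] (α (toℕ i) * f (toℕ i))

  ⟨⟩-+ʳ : ∀ α f g → ⟨ α , (λ x → f x + g x) ⟩ ≡ ⟨ α , f ⟩ + ⟨ α , g ⟩
  ⟨⟩-+ʳ α f g = trans (sum-cong-≗ {m} λ i → ℤ.*-distribˡ-+ (α (toℕ i)) (f (toℕ i)) (g (toℕ i)))
                      (∑-distrib-+ {m} (λ i → α (toℕ i) * f (toℕ i)) (λ i → α (toℕ i) * g (toℕ i)))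

  ⟨⟩-+ˡ : ∀ α β f → ⟨ (λ x → α x + β x) , f ⟩ ≡ ⟨ α , f ⟩ + ⟨ β , f ⟩
  ⟨⟩-+ˡ α β f = trans (sum-cong-≗ {m} λ i → ℤ.*-distribʳ-+ (f (toℕ i)) (α (toℕ i)) (β (toℕ i)))
                      (∑-distrib-+ {m} (λ i → α (toℕ i) * f (toℕ i)) (λ i → β (toℕ i) * f (toℕ i)))

  ⟨⟩-shift : Periodic α m → Periodic f m → ∀ a → a ≤ m →
             ⟨ α , (λ x → f (x ℕ.+ a)) ⟩ ≡ ⟨ (λ x → α (x ℕ.+ (m ∸ a))) , f ⟩
  ⟨⟩-shift {α} {f} α-per f-per a a≤m =
    trans (sum-cong-≗ {m} λ i → cong (_* f (toℕ i ℕ.+ a)) (sym (undo (toℕ i)))) (∑-rotate F-per a)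
    where
    F : ℕ → ℤ
    F x = α (x ℕ.+ (m ∸ a)) * f x
    undo : ∀ x → α (x ℕ.+ a ℕ.+ (m ∸ a)) ≡ α x
    undo x = trans (cong α (trans (ℕ.+-assoc x a (m ∸ a)) (cong (ℕ._+_ x) (ℕ.m+[n∸m]≡n a≤m)))) (α-per x)
    F-per : Periodic F m
    F-per x = cong₂ _*_ (trans (cong α (reorder x)) (α-per (x ℕ.+ (m ∸ a)))) (f-per x)
      where
      reorder : ∀ x → x ℕ.+ m ℕ.+ (m ∸ a) ≡ x ℕ.+ (m ∸ a) ℕ.+ m
      reorder x = trans (ℕ.+-assoc x m (m ∸ a))
                        (trans (cong (ℕ._+_ x) (ℕ.+-comm m (m ∸ a))) (sym (ℕ.+-assoc x (m ∸ a) m)))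

  shift±-self-adjoint : Periodic α m → Periodic f m → ∀ a → a ≤ m →
                        ⟨ α , shift± a f ⟩ ≡ ⟨ shift± a α , f ⟩
  shift±-self-adjoint {α} {f} α-per f-per a a≤m = begin
    ⟨ α , shift± a f ⟩
      ≡⟨ ⟨⟩-+ʳ α (λ x → f (x ℕ.+ a)) (λ x → f (x ℕ.+ (m ∸ a))) ⟩
    ⟨ α , (λ x → f (x ℕ.+ a)) ⟩ + ⟨ α , (λ x → f (x ℕ.+ (m ∸ a))) ⟩
      ≡⟨ cong₂ _+_ (⟨⟩-shift α-per f-per a a≤m) (⟨⟩-shift α-per f-per (m ∸ a) (ℕ.m∸n≤m m a)) ⟩
    ⟨ (λ x → α (x ℕ.+ (m ∸ a))) , f ⟩ + ⟨ (λ x → α (x ℕ.+ (m ∸ (m ∸ a)))) , f ⟩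
      ≡⟨ cong (λ b → ⟨ (λ x → α (x ℕ.+ (m ∸ a))) , f ⟩ + ⟨ (λ x → α (x ℕ.+ b)) , f ⟩)
              (ℕ.m∸[m∸n]≡n a≤m) ⟩
    ⟨ (λ x → α (x ℕ.+ (m ∸ a))) , f ⟩ + ⟨ (λ x → α (x ℕ.+ a)) , f ⟩
      ≡⟨ ℤ.+-comm ⟨ (λ x → α (x ℕ.+ (m ∸ a))) , f ⟩ ⟨ (λ x → α (x ℕ.+ a)) , f ⟩ ⟩
    ⟨ (λ x → α (x ℕ.+ a)) , f ⟩ + ⟨ (λ x → α (x ℕ.+ (m ∸ a))) , f ⟩
      ≡⟨ ⟨⟩-+ˡ (λ x → α (x ℕ.+ a)) (λ x → α (x ℕ.+ (m ∸ a))) f ⟨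
    ⟨ shift± a α , f ⟩ ∎

  closedSum-symmetric : Periodic α m → Periodic β m → Periodic f m → Periodic g m →
    ⟨ α , closedSumᵛ f g ⟩ + ⟨ β , closedSumᵘ f g ⟩
      ≡ ⟨ closedSumᵛ α β , f ⟩ + ⟨ closedSumᵘ α β , g ⟩
  closedSum-symmetric {α} {β} {f} {g} α-per β-per f-per g-per = begin
    ⟨ α , closedSumᵛ f g ⟩ + ⟨ β , closedSumᵘ f g ⟩
      ≡⟨ cong₂ _+_ (expandʳ α f (shift± 1 f) g) (expandʳ β g f (shift± j g)) ⟩
    (⟨ α , f ⟩ + (⟨ α , shift± 1 f ⟩ + ⟨ α , g ⟩)) + (⟨ β , g ⟩ + (⟨ β , f ⟩ + ⟨ β , shift± j g ⟩))
      ≡⟨ cong₂ _+_ (cong (λ s → ⟨ α , f ⟩ + (s + ⟨ α , g ⟩)) (shift±-self-adjoint α-per f-per 1 1≤m))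
                   (cong (λ s → ⟨ β , g ⟩ + (⟨ β , f ⟩ + s)) (shift±-self-adjoint β-per g-per j j≤m)) ⟩
    (⟨ α , f ⟩ + (⟨ shift± 1 α , f ⟩ + ⟨ α , g ⟩)) + (⟨ β , g ⟩ + (⟨ β , f ⟩ + ⟨ shift± j β , g ⟩))
      ≡⟨ exchange ⟨ α , f ⟩ ⟨ shift± 1 α , f ⟩ ⟨ α , g ⟩ ⟨ β , g ⟩ ⟨ β , f ⟩ ⟨ shift± j β , g ⟩ ⟩
    (⟨ α , f ⟩ + (⟨ shift± 1 α , f ⟩ + ⟨ β , f ⟩)) + (⟨ β , g ⟩ + (⟨ α , g ⟩ + ⟨ shift± j β , g ⟩))
      ≡⟨ cong₂ _+_ (expandˡ α (shift± 1 α) β f) (expandˡ β α (shift± j β) g) ⟨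
    ⟨ closedSumᵛ α β , f ⟩ + ⟨ closedSumᵘ α β , g ⟩ ∎
    where
    expandʳ : ∀ α f g h → ⟨ α , (λ x → f x + (g x + h x)) ⟩ ≡ ⟨ α , f ⟩ + (⟨ α , g ⟩ + ⟨ α , h ⟩)
    expandʳ α f g h = trans (⟨⟩-+ʳ α f (λ x → g x + h x)) (cong (_+_ ⟨ α , f ⟩) (⟨⟩-+ʳ α g h))
    expandˡ : ∀ α β γ f → ⟨ (λ x → α x + (β x + γ x)) , f ⟩ ≡ ⟨ α , f ⟩ + (⟨ β , f ⟩ + ⟨ γ , f ⟩)
    expandˡ α β γ f = trans (⟨⟩-+ˡ α (λ x → β x + γ x) f) (cong (_+_ ⟨ α , f ⟩) (⟨⟩-+ˡ β γ f))
    exchange : ∀ a b c d e f → (a + (b + c)) + (d + (e + f)) ≡ (a + (b + e)) + (d + (c + f))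
    exchange = solve-∀

  closedColoring-obstruction : ∀ {ℓ} → ClosedColoring (GP m j) n k ℓ → d ∣ + n →
    Periodic α m → Periodic β m → (∀ x → d ∣ closedSumᵛ α β x) → (∀ x → d ∣ closedSumᵘ α β x) →
    d ∣ ∑[ i < m ] (k * (α (toℕ i) + β (toℕ i)))
  closedColoring-obstruction {n} {k} {d} {α} {β} {ℓ} cc d∣n α-per β-per d∣Sᵛ d∣Sᵘ =
    ∣m+n∣m⇒∣n (subst (d ∣_) (sym weighted-sum) d∣pairing) d∣weighted
    where
    ℓᵛ ℓᵘ : ℕ → ℤ
    ℓᵛ = ℓ ∘ outer ∘ residue
    ℓᵘ = ℓ ∘ inner ∘ residue
    residualᵛ : ∀ i → d ∣ closedSumᵛ ℓᵛ ℓᵘ (toℕ i) - k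
    residualᵛ i = ∣-trans d∣n (subst (λ s → + n ∣ s - k)
                                     (closedSum-outer {ℓ = ℓ} (λ _ → refl) (λ _ → refl) i) (∣ᵤ⇒∣ (cc (outer i))))
    residualᵘ : ∀ i → d ∣ closedSumᵘ ℓᵛ ℓᵘ (toℕ i) - k
    residualᵘ i = ∣-trans d∣n (subst (λ s → + n ∣ s - k)
                                     (closedSum-inner {ℓ = ℓ} (λ _ → refl) (λ _ → refl) i) (∣ᵤ⇒∣ (cc (inner i))))
    W : Fin m → ℤ
    W i = α (toℕ i) * (closedSumᵛ ℓᵛ ℓᵘ (toℕ i) - k) + β (toℕ i) * (closedSumᵘ ℓᵛ ℓᵘ (toℕ i) - k)
    d∣weighted : d ∣ ∑[ i < m ] W i
    d∣weighted = ∑-∣ {m} W λ i →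
      ∣m∣n⇒∣m+n (∣n⇒∣m*n (α (toℕ i)) (residualᵛ i)) (∣n⇒∣m*n (β (toℕ i)) (residualᵘ i))
    d∣pairing : d ∣ ⟨ closedSumᵛ α β , ℓᵛ ⟩ + ⟨ closedSumᵘ α β , ℓᵘ ⟩
    d∣pairing = ∣m∣n⇒∣m+n
      (∑-∣ {m} (λ i → closedSumᵛ α β (toℕ i) * ℓᵛ (toℕ i)) λ i → ∣m⇒∣m*n (ℓᵛ (toℕ i)) (d∣Sᵛ (toℕ i)))
      (∑-∣ {m} (λ i → closedSumᵘ α β (toℕ i) * ℓᵘ (toℕ i)) λ i → ∣m⇒∣m*n (ℓᵘ (toℕ i)) (d∣Sᵘ (toℕ i)))
    collect : ∀ a b s u k → (a * (s - k) + b * (u - k)) + k * (a + b) ≡ a * s + b * u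
    collect = solve-∀
    weighted-sum : ∑[ i < m ] W i + ∑[ i < m ] (k * (α (toℕ i) + β (toℕ i)))
                     ≡ ⟨ closedSumᵛ α β , ℓᵛ ⟩ + ⟨ closedSumᵘ α β , ℓᵘ ⟩
    weighted-sum = begin
      ∑[ i < m ] W i + ∑[ i < m ] (k * (α (toℕ i) + β (toℕ i)))
        ≡⟨ ∑-distrib-+ {m} W (λ i → k * (α (toℕ i) + β (toℕ i))) ⟨
      ∑[ i < m ] (W i + k * (α (toℕ i) + β (toℕ i)))
        ≡⟨ sum-cong-≗ {m} (λ i → collect (α (toℕ i)) (β (toℕ i))
                                         (closedSumᵛ ℓᵛ ℓᵘ (toℕ i)) (closedSumᵘ ℓᵛ ℓᵘ (toℕ i)) k) ⟩
      ∑[ i < m ] (α (toℕ i) * closedSumᵛ ℓᵛ ℓᵘ (toℕ i) + β (toℕ i) * closedSumᵘ ℓᵛ ℓᵘ (toℕ i))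
        ≡⟨ ∑-distrib-+ {m} (λ i → α (toℕ i) * closedSumᵛ ℓᵛ ℓᵘ (toℕ i))
                           (λ i → β (toℕ i) * closedSumᵘ ℓᵛ ℓᵘ (toℕ i)) ⟩
      ⟨ α , closedSumᵛ ℓᵛ ℓᵘ ⟩ + ⟨ β , closedSumᵘ ℓᵛ ℓᵘ ⟩
        ≡⟨ closedSum-symmetric α-per β-per (λ x → cong (ℓ ∘ outer) (residue-periodic x))
                                          (λ x → cong (ℓ ∘ inner) (residue-periodic x)) ⟩
      ⟨ closedSumᵛ α β , ℓᵛ ⟩ + ⟨ closedSumᵘ α β , ℓᵘ ⟩ ∎

module RemainderTwo (m j : ℕ) .{{_ : NonZero m}} (3≤m : 3 ≤ m) (1≤j : 1 ≤ j) (2j<m : 2 ℕ.* j < m) where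
  open import Data.Nat.Base using (_+_; _*_)
  open import Data.Nat.Divisibility using (_∣_; _∣?_; divides; 1∣_; *-cancelˡ-∣; *-monoˡ-∣)
  import Data.Integer.Divisibility.Signed as ℤ
  open import Algebra.Properties.Semiring.Sum ℤ.+-*-semiring using (sum-syntax)
  open import Data.Nat.Tactic.RingSolver using (solve-∀)
  import Data.Integer.Tactic.RingSolver as ℤ-Solver
  open import Relation.Nullary using (yes; no)
  open Petersen m j 3≤m 1≤j 2j<m

  private variable
    n d : ℕ

  ≡2-mod : ∀ {s} q → s ≡ 2 + q * n → + n ℤ.∣ + s ℤ.- + 2
  ≡2-mod {n} q refl = ℤ.divides (+ q) (trans (cancel (+ 2) (+ (q * n))) (ℤ.pos-* q n))
    where
    cancel : ∀ a b → (a ℤ.+ b) ℤ.- a ≡ b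
    cancel = ℤ-Solver.solve-∀

  odd-part : d ∣ n → ¬ d * 2 ∣ n → ∃ λ s → n ≡ (1 + s * 2) * d
  odd-part {d} {n} (divides q n≡qd) ¬2d∣n with odd-decomposition q ¬2∣q
    where
    ¬2∣q : ¬ 2 ∣ q
    ¬2∣q (divides r q≡r2) = ¬2d∣n (divides r (trans n≡qd (trans (cong (_* d) q≡r2)
                                     (trans (ℕ.*-assoc r 2 d) (cong (_*_ r) (ℕ.*-comm 2 d))))))
  ... | s , q≡ = s , trans n≡qd (cong (_* d) q≡)

  chiExists-odd : ∀ s → n ≡ (1 + s * 2) * 1 → ChiExists (GP m j) n (+ 2)
  chiExists-odd s refl = chiExists-constant (+ (1 + s)) (+ (1 + s)) (≡2-mod 2 (v s)) (≡2-mod 2 (u s))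
    where
    v : ∀ s → (1 + s) + (((1 + s) + (1 + s)) + (1 + s)) ≡ 2 + 2 * ((1 + s * 2) * 1)
    v = solve-∀
    u : ∀ s → (1 + s) + ((1 + s) + ((1 + s) + (1 + s))) ≡ 2 + 2 * ((1 + s * 2) * 1)
    u = solve-∀

  chiExists-twice-odd : ∀ s → n ≡ (1 + s * 2) * 2 → ChiExists (GP m j) n (+ 2)
  chiExists-twice-odd s refl = chiExists-constant (+ (1 + s)) (+ (1 + s)) (≡2-mod 1 (v s)) (≡2-mod 1 (u s))
    where
    v : ∀ s → (1 + s) + (((1 + s) + (1 + s)) + (1 + s)) ≡ 2 + 1 * ((1 + s * 2) * 2)
    v = solve-∀
    u : ∀ s → (1 + s) + ((1 + s) + ((1 + s) + (1 + s))) ≡ 2 + 1 * ((1 + s * 2) * 2)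
    u = solve-∀

  chiExists-four-times-odd : ∀ s → n ≡ (1 + s * 2) * 4 → ChiExists (GP m j) n (+ 2)
  chiExists-four-times-odd s refl =
    chiExists-constant (+ (1 + s)) (+ (3 + 5 * s)) (≡2-mod 1 (v s)) (≡2-mod 2 (u s))
    where
    v : ∀ s → (1 + s) + (((1 + s) + (1 + s)) + (3 + 5 * s)) ≡ 2 + 1 * ((1 + s * 2) * 4)
    v = solve-∀
    u : ∀ s → (3 + 5 * s) + ((1 + s) + ((3 + 5 * s) + (3 + 5 * s))) ≡ 2 + 2 * ((1 + s * 2) * 4)
    u = solve-∀

  chiExists-¬8∣ : ¬ 8 ∣ n → ChiExists (GP m j) n (+ 2)
  chiExists-¬8∣ {n} ¬8∣n with 2 ∣? n | 4 ∣? n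
  ... | no ¬2∣n | _       = uncurry chiExists-odd (odd-part (1∣ n) ¬2∣n)
  ... | yes 2∣n | no ¬4∣n = uncurry chiExists-twice-odd (odd-part 2∣n ¬4∣n)
  ... | yes _   | yes 4∣n = uncurry chiExists-four-times-odd (odd-part 4∣n ¬8∣n)

  chiExists-j-odd : .{{_ : NonZero n}} → 2 ∣ m → ¬ 2 ∣ j → ChiExists (GP m j) n (+ 2)
  chiExists-j-odd {n} 2∣m ¬2∣j =
    chiExists-alternating 2∣m (+ 1) (+ 0) (+ 1) (+ 0) (alt-odd ¬2∣j) (alt-odd ¬2∣j)
      n∣0 n∣0 n∣0 n∣0
    where
    n∣0 : + n ℤ.∣ + 2 ℤ.- + 2
    n∣0 = ≡2-mod 0 refl

  chiExists-eight-times-odd : 2 ∣ m → 2 ∣ j → ∀ s → n ≡ (1 + s * 2) * 8 → ChiExists (GP m j) n (+ 2)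
  chiExists-eight-times-odd 2∣m 2∣j s refl =
    chiExists-alternating 2∣m (+ (7 + 13 * s)) (+ (1 + s)) (+ (1 + s)) (+ (3 + 5 * s))
      (alt-even 2∣j) (alt-even 2∣j)
      (≡2-mod 1 (v₀ s)) (≡2-mod 2 (v₁ s)) (≡2-mod 1 (u₀ s)) (≡2-mod 1 (u₁ s))
    where
    v₀ : ∀ s → (7 + 13 * s) + (((1 + s) + (1 + s)) + (1 + s)) ≡ 2 + 1 * ((1 + s * 2) * 8)
    v₀ = solve-∀
    v₁ : ∀ s → (1 + s) + (((7 + 13 * s) + (7 + 13 * s)) + (3 + 5 * s)) ≡ 2 + 2 * ((1 + s * 2) * 8)
    v₁ = solve-∀
    u₀ : ∀ s → (1 + s) + ((7 + 13 * s) + ((1 + s) + (1 + s))) ≡ 2 + 1 * ((1 + s * 2) * 8)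
    u₀ = solve-∀
    u₁ : ∀ s → (3 + 5 * s) + ((1 + s) + ((3 + 5 * s) + (3 + 5 * s))) ≡ 2 + 1 * ((1 + s * 2) * 8)
    u₁ = solve-∀

  ¬chiExists-m-odd : 8 ∣ n → ¬ 2 ∣ m → ¬ ChiExists (GP m j) n (+ 2)
  ¬chiExists-m-odd 8∣n ¬2∣m (ℓ , _ , coloring) = ¬2∣m (*-cancelˡ-∣ 4 (subst (8 ∣_) (ℕ.*-comm m 4) 8∣m*4))
    where
    8∣∑ : + 8 ℤ.∣ ∑[ i < m ] (+ 2 ℤ.* (- + 1 ℤ.+ + 3))
    8∣∑ = closedColoring-obstruction {k = + 2} {α = λ _ → - + 1} {β = λ _ → + 3} {ℓ = ℓ}
            coloring (ℤ.∣ᵤ⇒∣ 8∣n) (λ _ → refl) (λ _ → refl)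
            (λ _ → ℤ.divides 0ℤ refl) (λ _ → ℤ.divides (+ 1) refl)
    8∣m*4 : 8 ∣ m * 4
    8∣m*4 = ℤ.∣⇒∣ᵤ (subst (ℤ._∣_ (+ 8)) (trans (∑-const m (+ 4)) (sym (ℤ.pos-* m 4))) 8∣∑)

  ¬chiExists-16∣ : 16 ∣ n → 2 ∣ m → 2 ∣ j → ¬ 4 ∣ m → ¬ ChiExists (GP m j) n (+ 2)
  ¬chiExists-16∣ 16∣n 2∣m@(divides h m≡h*2) 2∣j ¬4∣m (ℓ , _ , coloring) = ¬4∣m 4∣m
    where
    α β F : ℕ → ℤ
    α = alt (- + 3) (+ 9)
    β = alt (+ 1) (- + 3)
    F x = + 2 ℤ.* (α x ℤ.+ β x)
    16∣∑ : + 16 ℤ.∣ ∑[ i < m ] F (toℕ i)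
    16∣∑ = closedColoring-obstruction {k = + 2} {α = α} {β = β} {ℓ = ℓ}
             coloring (ℤ.∣ᵤ⇒∣ 16∣n) (periodic-∣ alt-periodic 2∣m) (periodic-∣ alt-periodic 2∣m)
             (λ x → subst (ℤ._∣_ (+ 16)) (sym (closedSumᵛ-alt 2∣m x))
                          (alt-all (ℤ._∣_ (+ 16)) (ℤ.divides (+ 1) refl) (ℤ.divides 0ℤ refl) x))
             (λ x → subst (ℤ._∣_ (+ 16)) (sym (closedSumᵘ-alt 2∣m (alt-even 2∣j) (alt-even 2∣j) x))
                          (alt-all (ℤ._∣_ (+ 16)) (ℤ.divides 0ℤ refl) (ℤ.divides 0ℤ refl) x))
    ∑≡h*8 : ∑[ i < m ] F (toℕ i) ≡ + (h * 8)
    ∑≡h*8 = trans (cong (λ m′ → ∑[ i < m′ ] F (toℕ i)) m≡h*2)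
                  (trans (∑-periodic (λ x → cong₂ (λ a b → + 2 ℤ.* (a ℤ.+ b)) (alt-periodic x) (alt-periodic x)) h)
                         (sym (ℤ.pos-* h 8)))
    2∣h : 2 ∣ h
    2∣h = *-cancelˡ-∣ 8 (subst (16 ∣_) (ℕ.*-comm h 8) (ℤ.∣⇒∣ᵤ (subst (ℤ._∣_ (+ 16)) ∑≡h*8 16∣∑)))
    4∣m : 4 ∣ m
    4∣m = subst (4 ∣_) (sym m≡h*2) (*-monoˡ-∣ 2 2∣h)

open import Data.Nat using (ℕ; _<_; _≤_; _*_; NonZero)
open import Data.Nat.Divisibility using (_∣_)
open import Data.Integer using (+_)
open import Data.Product using (_×_)
open import Relation.Nullary using (¬_)
open import Function.Bundles using (_⇔_; mk⇔)

theorem7p6 : (n m j : ℕ) → 1 ≤ n → 3 ≤ m → 1 ≤ j → 2 * j < m →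
    (nz : NonZero m) →
    (¬ (8 ∣ n) → ChiExists (GP m j {{nz}}) n (+ 2)) ×
    (8 ∣ n → ¬ (2 ∣ m) → ¬ ChiExists (GP m j {{nz}}) n (+ 2)) ×
    (8 ∣ n → 2 ∣ m → ¬ (2 ∣ j) → ChiExists (GP m j {{nz}}) n (+ 2)) ×
    (8 ∣ n → 2 ∣ m → ¬ (4 ∣ m) → 2 ∣ j →
      (ChiExists (GP m j {{nz}}) n (+ 2) ⇔ (¬ (16 ∣ n))))
theorem7p6 n m j 1≤n 3≤m 1≤j 2j<m nz =
    chiExists-¬8∣
  , ¬chiExists-m-odd
  , (λ _ 2∣m ¬2∣j → chiExists-j-odd 2∣m ¬2∣j)
  , λ 8∣n 2∣m ¬4∣m 2∣j →
      mk⇔ (λ χ 16∣n → ¬chiExists-16∣ 16∣n 2∣m 2∣j ¬4∣m χ)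
          (λ ¬16∣n → uncurry (chiExists-eight-times-odd 2∣m 2∣j) (odd-part 8∣n ¬16∣n))
  where
  open RemainderTwo m j {{nz}} 3≤m 1≤j 2j<m
  instance
    n≢0 : NonZero n
    n≢0 = ℕ.>-nonZero 1≤n
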